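{- Let $d>2$ be an integer and consider the greedy partition of length $d$. If $d$ is odd, the smallest primitive integer of rank one is $3\cdot\frac{d+1}{2}$; if $d$ is even, the smallest primitive integer of rank one is $3\cdot\frac{d+2}{2}$.
   Context: Fix a positive integer $d$. The greedy partition of length $d$ of $\mathbb{N}_+$ is built by processing $n=1,2,3,\dots$ in order. At each stage every existing part has the form $\{k,2k,\dots,mk\}$ with $1\le m\le d$. The integer $n$ is appended to the existing part $\{k,\dots,mk\}$ with $n=(m+1)k$ and $m+1\le d$, choosing the one with smallest $k$ if several exist; if no such part exists, $n$ starts a new part $\{n\}$. An integer is primitive if it is the smallest element of its (final) part, and the rank of a primitive integer is the number of elements of its part; so a primitive of rank one forms a singleton part. -}

module Defs where

open import Data.Nat using (ℕ; zero; suc; _+_; _*_; _≤_; _≤?_; _≟_)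
open import Data.Nat.Properties using (≡-decSetoid)
open import Data.Bool using (Bool; true; false; if_then_else_; _∧_)
open import Data.List using (List; []; _∷_; _++_; [_]; map)
open import Data.List.Membership.Propositional using (_∈_)
open import Data.Maybe using (Maybe; just; nothing)
open import Data.Product using (_×_; _,_; proj₁)
open import Relation.Nullary.Decidable using (⌊_⌋)

-- A part {k, 2k, ..., mk} is represented by the pair (k , m).
Part : Set
Part = ℕ × ℕ

fits : ℕ → ℕ → Part → Bool
fits d n (k , m) = ⌊ n ≟ suc m * k ⌋ ∧ ⌊ suc m ≤? d ⌋

minM : Maybe ℕ → ℕ → Maybe ℕ
minM nothing  k = just k
minM (just j) k = if ⌊ j ≤? k ⌋ then just j else just k

bestK : ℕ → ℕ → List Part → Maybe ℕ
bestK d n []             = nothing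
bestK d n ((k , m) ∷ ps) with fits d n (k , m)
... | true  = minM (bestK d n ps) k
... | false = bestK d n ps

step : ℕ → ℕ → List Part → List Part
step d n ps with bestK d n ps
... | nothing = ps ++ [ (n , 1) ]
... | just k  = map (λ { (k' , m) → if ⌊ k' ≟ k ⌋ ∧ fits d n (k' , m)
                                    then (k' , suc m) else (k' , m) }) ps

greedyState : ℕ → ℕ → List Part
greedyState d zero    = []
greedyState d (suc N) = step d (suc N) (greedyState d N)

-- n is primitive of rank one: n is the smallest element of its final part
-- and that part is the singleton {n}; i.e. at every stage N ≥ n the
-- partition contains the part {n} = (n , 1).
PrimitiveRankOne : ℕ → ℕ → Set
PrimitiveRankOne d n = ∀ N → n ≤ N → (n , 1) ∈ greedyState d N

IsSmallestPrimitiveRankOne : ℕ → ℕ → Set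
IsSmallestPrimitiveRankOne d x =
  PrimitiveRankOne d x × (∀ n → PrimitiveRankOne d n → x ≤ n)

-- Up to stage d the only part is {1, …, d}, which is then full.  From there on every part is
-- {k}, {k, 2k} or {k, 2k, 3k} with k > d, and as long as n < 6c, where 2c is the least even
-- number above d, at most one part accepts n: n = 2k = 3j with k, j > d forces j to be even,
-- so j ≥ 2c and n ≥ 6c.  Below 6c the partition is therefore forced: every n with d < n ≤ 2d + 1
-- starts a singleton, and a singleton {k} is extended at 2k.  So no n < 3c is a singleton for
-- ever, whereas {3c} is: at 6c both {3c} and {2c, 4c} could take 6c, the greedy rule gives it
-- to the smaller 2c, and no later integer fits {3c}.  Finally 2c = d + 1 or d + 2 by parity.

module Submission where

open import Defs
open import Data.Bool using (true; false; if_then_else_; _∧_)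
open import Data.Empty using (⊥; ⊥-elim)
open import Data.List using (List; []; _∷_; [_]; map)
open import Data.List.Membership.Propositional using (_∈_)
open import Data.List.Membership.Propositional.Properties using (∈-map⁺; ∈-map⁻; ∈-++⁺ˡ; ∈-++⁺ʳ; ∈-++⁻)
open import Data.List.Relation.Unary.All using (All; []; _∷_; tabulate; lookup)
open import Data.List.Relation.Unary.Any using (here; there)
open import Data.Maybe using (just; nothing)
open import Data.Nat using (ℕ; zero; suc; pred; _+_; _*_; _⊔_; _<_; _≤_; _≟_; _≤?_; _<?_; s≤s; z≤n; z<s)
open import Data.Nat.Divisibility using (_∣_; divides; ∣m+n∣m⇒∣n; m%n≡0⇒n∣m)
open import Data.Nat.DivMod using (_/_; _%_; m*[n/m]≡n; %-distribˡ-+)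
open import Data.Nat.Properties
open import Data.Nat.Tactic.RingSolver using (solve-∀)
open import Data.Product using (_×_; _,_; proj₁; proj₂; ∃)
open import Data.Sum using (_⊎_; inj₁; inj₂)
open import Relation.Nullary using (yes; no)
open import Relation.Nullary.Decidable using (⌊_⌋)
open import Relation.Binary.PropositionalEquality
  using (_≡_; _≢_; refl; sym; trans; cong; subst)

fits-sound : ∀ {d n k m} → fits d n (k , m) ≡ true → n ≡ suc m * k × suc m ≤ d
fits-sound {d} {n} {k} {m} f with n ≟ suc m * k | suc m ≤? d
fits-sound _  | yes n≡ | yes m<d = n≡ , m<d
fits-sound () | yes _  | no _
fits-sound () | no _   | _

fits-complete : ∀ {d n k m} → n ≡ suc m * k → suc m ≤ d → fits d n (k , m) ≡ true
fits-complete {d} {n} {k} {m} n≡ m<d with n ≟ suc m * k | suc m ≤? d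
... | yes _  | yes _   = refl
... | yes _  | no m≮d = ⊥-elim (m≮d m<d)
... | no n≢  | _       = ⊥-elim (n≢ n≡)

fits-≢ : ∀ {d n k m} → n ≢ suc m * k → fits d n (k , m) ≡ false
fits-≢ {n = n} {k} {m} n≢ with n ≟ suc m * k
... | yes n≡ = ⊥-elim (n≢ n≡)
... | no _   = refl

true≢false : ∀ {b} → b ≡ true → b ≡ false → ⊥
true≢false refl ()

minM≢nothing : ∀ mb k → minM mb k ≢ nothing
minM≢nothing nothing  k ()
minM≢nothing (just i) k e with ⌊ i ≤? k ⌋
minM≢nothing (just i) k () | true
minM≢nothing (just i) k () | false

minM-just : ∀ {i k j} → minM (just i) k ≡ just j → (j ≡ i × i ≤ k) ⊎ (j ≡ k × k < i)
minM-just {i} {k} e with i ≤? k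
minM-just refl | yes i≤k = inj₁ (refl , i≤k)
minM-just refl | no i≰k  = inj₂ (refl , ≰⇒> i≰k)

bestK-nothing : ∀ {d n ps p} → bestK d n ps ≡ nothing → p ∈ ps → fits d n p ≡ false
bestK-nothing {d} {n} {(k , m) ∷ ps} e p∈ with fits d n (k , m) in f | p∈
... | true  | _          = ⊥-elim (minM≢nothing (bestK d n ps) k e)
... | false | here refl  = f
... | false | there p∈′  = bestK-nothing e p∈′

bestK-just-fits : ∀ {d n ps j} → bestK d n ps ≡ just j →
                  ∃ λ m → (j , m) ∈ ps × fits d n (j , m) ≡ true
bestK-just-fits {d} {n} {(k , m) ∷ ps} e with fits d n (k , m) in f
... | false with bestK-just-fits e
...   | m′ , j∈ , fj = m′ , there j∈ , fj
bestK-just-fits {d} {n} {(k , m) ∷ ps} e | true with bestK d n ps in b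
... | nothing with e
...   | refl = m , here refl , f
bestK-just-fits {d} {n} {(k , m) ∷ ps} e | true | just i with minM-just e | bestK-just-fits b
... | inj₁ (refl , _) | m′ , i∈ , fi = m′ , there i∈ , fi
... | inj₂ (refl , _) | _ = m , here refl , f

bestK-just-least : ∀ {d n ps j k m} → bestK d n ps ≡ just j → (k , m) ∈ ps →
                   fits d n (k , m) ≡ true → j ≤ k
bestK-just-least {d} {n} {(k′ , m″) ∷ ps} e k∈ fk with fits d n (k′ , m″) in f
bestK-just-least e (here refl) fk | false = ⊥-elim (true≢false fk f)
bestK-just-least e (there k∈) fk  | false = bestK-just-least e k∈ fk
bestK-just-least {d} {n} {(k′ , m″) ∷ ps} e k∈ fk | true with bestK d n ps in b
bestK-just-least refl (here refl) fk | true | nothing = ≤-refl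
bestK-just-least refl (there k∈) fk  | true | nothing = ⊥-elim (true≢false fk (bestK-nothing b k∈))
bestK-just-least {d} {n} {(k′ , m″) ∷ ps} e k∈ fk | true | just i with minM-just e | k∈
... | inj₁ (refl , i≤k′) | here refl = i≤k′
... | inj₁ (refl , _)    | there k∈′ = bestK-just-least b k∈′ fk
... | inj₂ (refl , _)    | here refl = ≤-refl
... | inj₂ (refl , k′<i) | there k∈′ = ≤-trans (<⇒≤ k′<i) (bestK-just-least b k∈′ fk)

update-unchanged : ∀ {d n j k m} → k ≢ j ⊎ fits d n (k , m) ≡ false →
  (if ⌊ k ≟ j ⌋ ∧ fits d n (k , m) then (k , suc m) else (k , m)) ≡ (k , m)
update-unchanged {j = j} {k} other⊎unfit with k ≟ j | other⊎unfit
... | no _     | _           = refl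
... | yes refl | inj₁ k≢k    = ⊥-elim (k≢k refl)
... | yes refl | inj₂ unfit  rewrite unfit = refl

update-extends : ∀ {d n k m} → fits d n (k , m) ≡ true →
  (if ⌊ k ≟ k ⌋ ∧ fits d n (k , m) then (k , suc m) else (k , m)) ≡ (k , suc m)
update-extends {k = k} fit with k ≟ k
... | yes _   rewrite fit = refl
... | no k≢k  = ⊥-elim (k≢k refl)

∈-map-≡ : ∀ {A B : Set} (f : A → B) {x y xs} → x ∈ xs → f x ≡ y → y ∈ map f xs
∈-map-≡ f x∈ refl = ∈-map⁺ f x∈

∈-step-unfit : ∀ {d n ps p} → p ∈ ps → fits d n p ≡ false → p ∈ step d n ps
∈-step-unfit {d} {n} {ps} {k , m} p∈ unfit with bestK d n ps
... | nothing = ∈-++⁺ˡ p∈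
... | just j  = ∈-map-≡ _ p∈ (update-unchanged {d} {n} (inj₂ unfit))

∈-step-created : ∀ {d n ps} → (∀ {p} → p ∈ ps → fits d n p ≡ false) → (n , 1) ∈ step d n ps
∈-step-created {d} {n} {ps} allUnfit with bestK d n ps in e
... | nothing = ∈-++⁺ʳ ps (here refl)
... | just j with bestK-just-fits e
...   | _ , j∈ , fj = ⊥-elim (true≢false fj (allUnfit j∈))

∈-step-extended : ∀ {d n ps k m} → (k , m) ∈ ps → fits d n (k , m) ≡ true →
                  (∀ {j m′} → (j , m′) ∈ ps → fits d n (j , m′) ≡ true → k ≤ j) →
                  (k , suc m) ∈ step d n ps
∈-step-extended {d} {n} {ps} k∈ fk least with bestK d n ps in e
... | nothing = ⊥-elim (true≢false fk (bestK-nothing e k∈))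
... | just i with bestK-just-fits e
...   | _ , i∈ , fi with ≤-antisym (bestK-just-least e k∈ fk) (least i∈ fi)
...     | refl = ∈-map-≡ _ k∈ (update-extends {d} {n} fk)

∈-step-bypassed : ∀ {d n ps k m j m′} → (k , m) ∈ ps → (j , m′) ∈ ps →
                  fits d n (j , m′) ≡ true → j < k → (k , m) ∈ step d n ps
∈-step-bypassed {d} {n} {ps} {k} {m} k∈ j∈ fj j<k with bestK d n ps in e
... | nothing = ⊥-elim (true≢false fj (bestK-nothing e j∈))
... | just i  = ∈-map-≡ _ k∈ (update-unchanged {d} {n} {_} {k} {m} (inj₁ k≢i))
  where
    k≢i : k ≢ i
    k≢i refl = <⇒≱ j<k (bestK-just-least e j∈ fj)

data StepOrigin (d n : ℕ) (ps : List Part) : Part → Set where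
  created  : StepOrigin d n ps (n , 1)
  extended : ∀ {k m} → (k , m) ∈ ps → fits d n (k , m) ≡ true → StepOrigin d n ps (k , suc m)
  kept     : ∀ {p} → p ∈ ps → fits d n p ≡ false → StepOrigin d n ps p
  bypassed : ∀ {k m j m′} → (k , m) ∈ ps → (j , m′) ∈ ps →
             fits d n (k , m) ≡ true → fits d n (j , m′) ≡ true → k ≢ j → StepOrigin d n ps (k , m)

∈-step⁻ : ∀ {d n ps q} → q ∈ step d n ps → StepOrigin d n ps q
∈-step⁻ {d} {n} {ps} q∈ with bestK d n ps in e
... | nothing with ∈-++⁻ ps q∈
...   | inj₁ q∈ps        = kept q∈ps (bestK-nothing e q∈ps)
...   | inj₂ (here refl) = created
∈-step⁻ {d} {n} {ps} q∈ | just j with ∈-map⁻ _ q∈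
... | (k , m) , k∈ , refl with k ≟ j | fits d n (k , m) in fk
...   | yes refl | true  = extended k∈ fk
...   | yes refl | false = kept k∈ fk
...   | no _     | false = kept k∈ fk
...   | no k≢j   | true with bestK-just-fits e
...     | _ , j∈ , fj = bypassed k∈ j∈ fk fj k≢j

persist : ∀ {d k m a b} → (k , m) ∈ greedyState d a → a ≤ b →
          (∀ {n} → a < n → n ≤ b → n ≢ suc m * k) → (k , m) ∈ greedyState d b
persist {d} {k} {m} k∈ a≤b avoid with m≤n⇒m<n∨m≡n a≤b
... | inj₂ refl = k∈
... | inj₁ (s≤s a≤b′) =
  ∈-step-unfit (persist k∈ a≤b′ (λ a<n n≤b′ → avoid a<n (m≤n⇒m≤1+n n≤b′)))
               (fits-≢ {d} {suc _} {k} {m} (avoid (s≤s a≤b′) ≤-refl))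

persist-until : ∀ {d k m a b} → (k , m) ∈ greedyState d a → a ≤ b → b < suc m * k →
                (k , m) ∈ greedyState d b
persist-until k∈ a≤b b<next = persist k∈ a≤b (λ _ n≤b → <⇒≢ (≤-<-trans n≤b b<next))

persist-after : ∀ {d k m a b} → (k , m) ∈ greedyState d a → suc m * k ≤ a → a ≤ b →
                (k , m) ∈ greedyState d b
persist-after k∈ next≤a a≤b = persist k∈ a≤b (λ a<n _ n≡ → <⇒≢ (≤-<-trans next≤a a<n) (sym n≡))

∈-greedyState-bypassed : ∀ {d n k m j m′} → (k , m) ∈ greedyState d (pred n) →
                         (j , m′) ∈ greedyState d (pred n) → fits d n (j , m′) ≡ true → j < k →
                         (k , m) ∈ greedyState d n
∈-greedyState-bypassed {n = suc _} = ∈-step-bypassed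

step-singleton : ∀ {d n k m} → fits d n (k , m) ≡ true → step d n [ (k , m) ] ≡ [ (k , suc m) ]
step-singleton {d} {n} {k} {m} fk with bestK d n [ (k , m) ] in e
... | nothing = ⊥-elim (true≢false fk (bestK-nothing {d} {n} e (here refl)))
... | just j with bestK-just-fits {d} {n} {[ (k , m) ]} e
...   | _ , here refl , _ = cong [_] (update-extends {d} {n} fk)

greedyState-initial : ∀ {d N} → 1 ≤ N → N ≤ d → greedyState d N ≡ [ (1 , N) ]
greedyState-initial {N = suc zero} _ _   = refl
greedyState-initial {d} {suc (suc N)} _ N<d
  rewrite greedyState-initial {d} {suc N} (s≤s z≤n) (<⇒≤ N<d) =
  step-singleton {d} {suc (suc N)} (fits-complete {d} {suc (suc N)} {1} (sym (*-identityʳ _)) N<d)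

data EarlyPart (d N : ℕ) : Part → Set where
  full   : EarlyPart d N (1 , d)
  single : ∀ {k} → d < k → N < 2 * k → EarlyPart d N (k , 1)
  double : ∀ {k} → d < k → EarlyPart d N (k , 2)
  triple : ∀ {k} → d < k → EarlyPart d N (k , 3)

n<2*n : ∀ {x} → 0 < x → x < 2 * x
n<2*n {x} 0<x = subst (x <_) (cong (x +_) (sym (+-identityʳ x))) (m<m+n x 0<x)

pred[n]<n : ∀ {x} → 0 < x → pred x < x
pred[n]<n {suc x} _ = ≤-refl

persist-until-next : ∀ {d k m a} → (k , m) ∈ greedyState d a → a < suc m * k →
                     (k , m) ∈ greedyState d (pred (suc m * k))
persist-until-next k∈ a<next = persist-until k∈ (<⇒≤pred a<next) (pred[n]<n (≤-<-trans z≤n a<next))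

module SmallestRankOne (d c : ℕ) (2<d : 2 < d) (d<2c : d < 2 * c) (2c≤2+d : 2 * c ≤ 2 + d) where

  open ≤-Reasoning

  S : ℕ → List Part
  S = greedyState d

  2≤d : 2 ≤ d
  2≤d = <⇒≤ 2<d

  0<c : 0 < c
  0<c = *-cancelˡ-< 2 0 c (≤-<-trans z≤n d<2c)

  c<d : c < d
  c<d = *-cancelˡ-< 2 c d (begin-strict
    2 * c  ≤⟨ 2c≤2+d ⟩
    2 + d  <⟨ +-monoˡ-< d 2<d ⟩
    d + d  ≡⟨ cong (d +_) (sym (+-identityʳ d)) ⟩
    2 * d  ∎)

  c≤half : ∀ {i} → d < 2 * i → c ≤ i
  c≤half {i} d<2i = ≤-pred (*-cancelˡ-< 2 c (suc i) (begin-strict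
    2 * c        ≤⟨ 2c≤2+d ⟩
    2 + d        ≤⟨ s≤s d<2i ⟩
    suc (2 * i)  <⟨ n<1+n _ ⟩
    2 + 2 * i    ≡⟨ *-suc 2 i ⟨
    2 * suc i    ∎))

  6c≡3[2c] : 2 * (3 * c) ≡ 3 * (2 * c)
  6c≡3[2c] = lemma c
    where lemma : ∀ c → 2 * (3 * c) ≡ 3 * (2 * c)
          lemma = solve-∀

  6c≤4k : ∀ {k} → d < k → 2 * (3 * c) ≤ 4 * k
  6c≤4k {k} d<k = begin
    2 * (3 * c)      ≡⟨ 6c≡3[2c] ⟩
    3 * (2 * c)      ≤⟨ *-monoʳ-≤ 3 2c≤2+d ⟩
    3 * (2 + d)      ≡⟨ e₁ d ⟩
    3 * d + (2 + 4)  ≤⟨ +-monoʳ-≤ (3 * d) (+-monoˡ-≤ 4 2≤d) ⟩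
    3 * d + (d + 4)  ≡⟨ e₂ d ⟩
    4 * suc d        ≤⟨ *-monoʳ-≤ 4 d<k ⟩
    4 * k            ∎
    where e₁ : ∀ d → 3 * (2 + d) ≡ 3 * d + (2 + 4)
          e₁ = solve-∀
          e₂ : ∀ d → 3 * d + (d + 4) ≡ 4 * suc d
          e₂ = solve-∀

  not-double-and-triple : ∀ {k j} → d < j → 2 * k ≡ 3 * j → 3 * j < 2 * (3 * c) → ⊥
  not-double-and-triple {k} {j} d<j 2k≡3j 3j<6c =
    odd (∣m+n∣m⇒∣n {2} {2 * j} {j} 2∣2j+j (divides j (*-comm 2 j)))
    where
      2∣2j+j : 2 ∣ 2 * j + j
      2∣2j+j = divides k (trans (+-comm (2 * j) j) (trans (sym 2k≡3j) (*-comm 2 k)))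
      odd : 2 ∣ j → ⊥
      odd (divides i j≡i*2) = <⇒≱ 3j<6c (begin
        2 * (3 * c)  ≡⟨ 6c≡3[2c] ⟩
        3 * (2 * c)  ≤⟨ *-monoʳ-≤ 3 (*-monoʳ-≤ 2 (c≤half {i} (subst (d <_) j≡2i d<j))) ⟩
        3 * (2 * i)  ≡⟨ cong (3 *_) j≡2i ⟨
        3 * j        ∎)
        where
          j≡2i : j ≡ 2 * i
          j≡2i = trans j≡i*2 (*-comm i 2)

  full-unfit : ∀ {n} → fits d n (1 , d) ≡ true → ⊥
  full-unfit fit = n≮n d (proj₂ (fits-sound fit))

  triple-unfit : ∀ {n k} → d < k → n < 2 * (3 * c) → fits d n (k , 3) ≡ true → ⊥
  triple-unfit {n} {k} d<k n<6c fit = <⇒≱ n<6c (begin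
    2 * (3 * c)  ≤⟨ 6c≤4k d<k ⟩
    4 * k        ≡⟨ proj₁ (fits-sound {k = k} fit) ⟨
    n            ∎)

  early-fits : ∀ {N n k m} → EarlyPart d N (k , m) → fits d n (k , m) ≡ true → n < 2 * (3 * c) →
               d < k × (n ≡ 2 * k ⊎ n ≡ 3 * k)
  early-fits full               fit _    = ⊥-elim (full-unfit fit)
  early-fits (single {k} d<k _) fit _    = d<k , inj₁ (proj₁ (fits-sound {k = k} fit))
  early-fits (double {k} d<k)   fit _    = d<k , inj₂ (proj₁ (fits-sound {k = k} fit))
  early-fits (triple d<k)       fit n<6c = ⊥-elim (triple-unfit d<k n<6c fit)

  multiples-unique : ∀ {n k j} → d < k → d < j → n ≡ 2 * k ⊎ n ≡ 3 * k → n ≡ 2 * j ⊎ n ≡ 3 * j →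
                     n < 2 * (3 * c) → k ≡ j
  multiples-unique {k = k} {j} _ _ (inj₁ refl) (inj₁ 2k≡2j) _ = *-cancelˡ-≡ k j 2 2k≡2j
  multiples-unique {k = k} {j} _ _ (inj₂ refl) (inj₂ 3k≡3j) _ = *-cancelˡ-≡ k j 3 3k≡3j
  multiples-unique {k = k} {j} _ d<j (inj₁ refl) (inj₂ 2k≡3j) n<6c =
    ⊥-elim (not-double-and-triple {k} {j} d<j 2k≡3j (subst (_< 2 * (3 * c)) 2k≡3j n<6c))
  multiples-unique {k = k} {j} d<k _ (inj₂ refl) (inj₁ 3k≡2j) n<6c =
    ⊥-elim (not-double-and-triple {j} {k} d<k (sym 3k≡2j) n<6c)

  early-fits-unique : ∀ {N n k m j m′} → EarlyPart d N (k , m) → EarlyPart d N (j , m′) →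
                      fits d n (k , m) ≡ true → fits d n (j , m′) ≡ true → n < 2 * (3 * c) → k ≡ j
  early-fits-unique {n = n} {k} {_} {j} ek ej fk fj n<6c with early-fits ek fk n<6c | early-fits ej fj n<6c
  ... | d<k , n≡k | d<j , n≡j = multiples-unique {n} {k} {j} d<k d<j n≡k n≡j n<6c

  early-extend : ∀ {N N′ n k m} → EarlyPart d N (k , m) → fits d n (k , m) ≡ true → n < 2 * (3 * c) →
                 EarlyPart d N′ (k , suc m)
  early-extend full           fit _    = ⊥-elim (full-unfit fit)
  early-extend (single d<k _) _   _    = double d<k
  early-extend (double d<k)   _   _    = triple d<k
  early-extend (triple d<k)   fit n<6c = ⊥-elim (triple-unfit d<k n<6c fit)

  early-age : ∀ {N p} → EarlyPart d N p → fits d (suc N) p ≡ false → EarlyPart d (suc N) p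
  early-age full                      _     = full
  early-age {N} (single {k} d<k N<2k) unfit =
    single d<k (≤∧≢⇒< N<2k (λ n≡2k → true≢false (fits-complete {d} {suc N} {k} n≡2k 2≤d) unfit))
  early-age (double d<k)              _     = double d<k
  early-age (triple d<k)              _     = triple d<k

  early-step : ∀ {N ps} → d ≤ N → suc N < 2 * (3 * c) → All (EarlyPart d N) ps →
               All (EarlyPart d (suc N)) (step d (suc N) ps)
  early-step {N} {ps} d≤N n<6c early = tabulate λ q∈ → origin (∈-step⁻ q∈)
    where
      origin : ∀ {q} → StepOrigin d (suc N) ps q → EarlyPart d (suc N) q
      origin created                   = single (s≤s d≤N) (n<2*n z<s)
      origin (extended k∈ fk)          = early-extend (lookup early k∈) fk n<6c
      origin (kept p∈ unfit)           = early-age (lookup early p∈) unfit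
      origin (bypassed k∈ j∈ fk fj k≢j) =
        ⊥-elim (k≢j (early-fits-unique (lookup early k∈) (lookup early j∈) fk fj n<6c))

  early-invariant : ∀ {N} → d ≤ N → N < 2 * (3 * c) → All (EarlyPart d N) (S N)
  early-invariant {zero} d≤0 _ = ⊥-elim (<⇒≱ (<-trans z<s 2<d) d≤0)
  early-invariant {suc N} d≤N N<6c with m≤n⇒m<n∨m≡n d≤N
  ... | inj₁ (s≤s d≤N′) = early-step d≤N′ N<6c (early-invariant d≤N′ (<-trans (n<1+n N) N<6c))
  ... | inj₂ refl rewrite greedyState-initial {suc N} {suc N} (s≤s z≤n) ≤-refl = full ∷ []

  multiple-large : ∀ {n k} → d < k → n ≡ 2 * k ⊎ n ≡ 3 * k → 2 * suc d ≤ n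
  multiple-large d<k (inj₁ refl) = *-monoʳ-≤ 2 d<k
  multiple-large {k = k} d<k (inj₂ refl) = ≤-trans (*-monoʳ-≤ 2 d<k) (*-monoˡ-≤ k (n≤1+n 2))

  single-appears : ∀ {n} → d < n → n ≤ suc (2 * d) → n < 2 * (3 * c) → (n , 1) ∈ S n
  single-appears {suc N} (s≤s d≤N) n≤1+2d n<6c = ∈-step-created (λ p∈ → unfit (lookup early p∈))
    where
      early : All (EarlyPart d N) (S N)
      early = early-invariant d≤N (<-trans (n<1+n N) n<6c)
      unfit : ∀ {p} → EarlyPart d N p → fits d (suc N) p ≡ false
      unfit {k , m} ep with fits d (suc N) (k , m) in f
      ... | false = refl
      ... | true with early-fits ep f n<6c
      ...   | d<k , n≡k = ⊥-elim (<⇒≱ (≤-<-trans n≤1+2d (≤-reflexive (sym (*-suc 2 d))))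
                                       (multiple-large {suc N} {k} d<k n≡k))

  extended-early : ∀ {n k m} → d < n → n < 2 * (3 * c) → (k , m) ∈ S (pred n) →
                   fits d n (k , m) ≡ true → (k , suc m) ∈ S n
  extended-early {suc N} {k} {m} (s≤s d≤N) n<6c k∈ fk = ∈-step-extended k∈ fk least
    where
      early : All (EarlyPart d N) (S N)
      early = early-invariant d≤N (<-trans (n<1+n N) n<6c)
      least : ∀ {j m′} → (j , m′) ∈ S N → fits d (suc N) (j , m′) ≡ true → k ≤ j
      least j∈ fj = ≤-reflexive (early-fits-unique (lookup early k∈) (lookup early j∈) fk fj n<6c)

  early-single-pending : ∀ {N k} → EarlyPart d N (k , 1) → N < 2 * k
  early-single-pending full           = ⊥-elim (<⇒≱ 2<d (s≤s z≤n))
  early-single-pending (single _ N<2k) = N<2k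

  2c<3c : 2 * c < 3 * c
  2c<3c = m<n+m (2 * c) 0<c

  3c<6c : 3 * c < 2 * (3 * c)
  3c<6c = n<2*n (≤-<-trans z≤n 2c<3c)

  2c<4c : 2 * c < 2 * (2 * c)
  2c<4c = n<2*n (≤-<-trans z≤n d<2c)

  4c<6c : 2 * (2 * c) < 2 * (3 * c)
  4c<6c = *-monoʳ-< 2 2c<3c

  d<3c : d < 3 * c
  d<3c = <-trans d<2c 2c<3c

  3c≤1+2d : 3 * c ≤ suc (2 * d)
  3c≤1+2d = ≤-pred (begin
    suc c + 2 * c      ≤⟨ +-mono-≤ c<d 2c≤2+d ⟩
    d + (2 + d)        ≡⟨ e d ⟩
    suc (suc (2 * d))  ∎)
    where e : ∀ d → d + (2 + d) ≡ suc (suc (2 * d))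
          e = solve-∀

  3c-born : (3 * c , 1) ∈ S (3 * c)
  3c-born = single-appears d<3c 3c≤1+2d 3c<6c

  2c-doubled : (2 * c , 2) ∈ S (2 * (2 * c))
  2c-doubled = extended-early (<-trans d<2c 2c<4c) 4c<6c
    (persist-until-next (single-appears d<2c (≤-trans (<⇒≤ 2c<3c) 3c≤1+2d) (<-trans 2c<3c 3c<6c)) 2c<4c)
    (fits-complete {d} {2 * (2 * c)} {2 * c} {1} refl 2≤d)

  3c-survives : (3 * c , 1) ∈ S (2 * (3 * c))
  3c-survives = ∈-greedyState-bypassed {d} {2 * (3 * c)} (persist-until-next 3c-born 3c<6c)
    (subst (λ t → (2 * c , 2) ∈ S (pred t)) (sym 6c≡3[2c])
           (persist-until-next 2c-doubled (subst (2 * (2 * c) <_) 6c≡3[2c] 4c<6c)))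
    (fits-complete {d} {2 * (3 * c)} {2 * c} {2} 6c≡3[2c] 2<d) 2c<3c

  rank-one : PrimitiveRankOne d (3 * c)
  rank-one N 3c≤N with N <? 2 * (3 * c)
  ... | yes N<6c = persist-until 3c-born 3c≤N N<6c
  ... | no N≮6c  = persist-after 3c-survives ≤-refl (≮⇒≥ N≮6c)

  least-rank-one : ∀ n → PrimitiveRankOne d n → 3 * c ≤ n
  least-rank-one n prim = ≮⇒≥ λ n<3c → <⇒≱ (early-single-pending (lookup (early n<3c) n∈)) 2n≤N
    where
      -- by stage N the singleton {n} has already been offered 2n
      N : ℕ
      N = d ⊔ 2 * n
      2n≤N : 2 * n ≤ N
      2n≤N = m≤n⊔m d (2 * n)
      n∈ : (n , 1) ∈ S N
      n∈ = prim N (≤-trans (m≤m+n n (n + 0)) 2n≤N)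
      early : n < 3 * c → All (EarlyPart d N) (S N)
      early n<3c = early-invariant (m≤m⊔n d (2 * n)) (⊔-lub (<-trans d<3c 3c<6c) (*-monoʳ-< 2 n<3c))

  smallest : IsSmallestPrimitiveRankOne d (3 * c)
  smallest = rank-one , least-rank-one

half-bounds : ∀ {d} c {r} → 0 < r → r ≤ 2 → 2 * c ≡ d + r → d < 2 * c × 2 * c ≤ 2 + d
half-bounds {d} _ 0<r r≤2 2c≡d+r =
  subst (d <_) (sym 2c≡d+r) (m<m+n d 0<r) ,
  subst (_≤ 2 + d) (sym 2c≡d+r) (≤-trans (+-monoʳ-≤ d r≤2) (≤-reflexive (+-comm d 2)))

double-half-odd : ∀ d → d % 2 ≡ 1 → 2 * ((d + 1) / 2) ≡ d + 1
double-half-odd d odd =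
  m*[n/m]≡n (m%n≡0⇒n∣m (d + 1) 2 (trans (%-distribˡ-+ d 1 2) (cong (λ r → (r + 1 % 2) % 2) odd)))

double-half-even : ∀ d → d % 2 ≡ 0 → 2 * ((d + 2) / 2) ≡ d + 2
double-half-even d even =
  m*[n/m]≡n (m%n≡0⇒n∣m (d + 2) 2 (trans (%-distribˡ-+ d 2 2) (cong (λ r → (r + 2 % 2) % 2) even)))

smallestPrimitiveRankOne : ∀ {d} c → 2 < d → d < 2 * c × 2 * c ≤ 2 + d →
                           IsSmallestPrimitiveRankOne d (3 * c)
smallestPrimitiveRankOne {d} c 2<d (d<2c , 2c≤2+d) = SmallestRankOne.smallest d c 2<d d<2c 2c≤2+d

mainTheorem12 : ∀ (d : ℕ) → 2 < d →
    ((d % 2 ≡ 1 → IsSmallestPrimitiveRankOne d (3 * ((d + 1) / 2)))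
    × (d % 2 ≡ 0 → IsSmallestPrimitiveRankOne d (3 * ((d + 2) / 2))))
mainTheorem12 d 2<d =
  (λ odd  → smallestPrimitiveRankOne c₁ 2<d (half-bounds c₁ z<s (s≤s z≤n) (double-half-odd d odd))) ,
  (λ even → smallestPrimitiveRankOne c₂ 2<d (half-bounds c₂ z<s ≤-refl (double-half-even d even)))
  where
    c₁ c₂ : ℕ
    c₁ = (d + 1) / 2
    c₂ = (d + 2) / 2
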